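{- Let $k\ge1$ and $n\ge1$. The family $\mathcal{F}_n(k)$ of $F_{k,k+2}$-increasing trees of order $n$ is in bijection with the family $\mathcal{B}_n(k)$ of $k$-bundled increasing trees of order $n$.
   Context: A $k$-bundled increasing tree of order $n$ is a rooted tree with vertex set $\{1,\dots,n\}$, root $1$, labels increasing along paths away from the root, in which every vertex has $k$ ordered bundles, each containing a (possibly empty) linearly ordered sequence of children; each non-root vertex lies in exactly one bundle of its parent. An $F_{k,k+2}$-increasing tree of order $n$ is a rooted tree on $\{1,\dots,n\}$ with root $1$ and labels increasing along paths away from the root, in which the root has $k$ positions and every other vertex has $k+2$ positions (numbered from left to right), each position empty or occupied by exactly one child, and every non-root vertex occupies exactly one position of its parent. -}

module Defs where

open import Data.Nat using (ℕ; zero; suc; _+_; _<_)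
open import Data.Nat.Properties using (≤-decTotalOrder)
open import Data.List using (List; []; _∷_; _++_; map; upTo)
open import Data.Vec using (Vec; []; _∷_)
open import Data.Maybe using (Maybe; just; nothing)
open import Data.Product using (Σ; _×_; _,_)
open import Data.Unit using (⊤)
open import Relation.Binary.PropositionalEquality using (_≡_)
open import Data.List.Sort.InsertionSort.Base ≤-decTotalOrder using (sort)

oneTo : ℕ → List ℕ
oneTo n = map suc (upTo n)

-- k-bundled increasing trees
-- A vertex carries a label and k ordered bundles, each bundle being a
-- (possibly empty) linearly ordered list of child subtrees.

data BTree (k : ℕ) : Set where
  bnode : ℕ → Vec (List (BTree k)) k → BTree k

broot : ∀ {k} → BTree k → ℕ
broot (bnode v _) = v

mutual
  blabels : ∀ {k} → BTree k → List ℕ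
  blabels (bnode v bs) = v ∷ blabelsV bs

  blabelsV : ∀ {k m} → Vec (List (BTree k)) m → List ℕ
  blabelsV [] = []
  blabelsV (l ∷ ls) = blabelsL l ++ blabelsV ls

  blabelsL : ∀ {k} → List (BTree k) → List ℕ
  blabelsL [] = []
  blabelsL (t ∷ ts) = blabels t ++ blabelsL ts

mutual
  BIncreasing : ∀ {k} → BTree k → Set
  BIncreasing (bnode v bs) = BIncV v bs

  BIncV : ∀ {k m} → ℕ → Vec (List (BTree k)) m → Set
  BIncV v [] = ⊤
  BIncV v (l ∷ ls) = BIncL v l × BIncV v ls

  BIncL : ∀ {k} → ℕ → List (BTree k) → Set
  BIncL v [] = ⊤
  BIncL v (t ∷ ts) = (v < broot t) × BIncreasing t × BIncL v ts

IsBundledIncTree : (k n : ℕ) → BTree k → Set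
IsBundledIncTree k n t =
  (broot t ≡ 1) × (sort (blabels t) ≡ oneTo n) × BIncreasing t

BundledIncTree : (k n : ℕ) → Set
BundledIncTree k n = Σ (BTree k) (IsBundledIncTree k n)

-- F_{k,k+2}-increasing trees
-- A non-root vertex has m = k+2 positions, each empty or holding one child.

data PTree (m : ℕ) : Set where
  pnode : ℕ → Vec (Maybe (PTree m)) m → PTree m

proot : ∀ {m} → PTree m → ℕ
proot (pnode v _) = v

mutual
  plabels : ∀ {m} → PTree m → List ℕ
  plabels (pnode v cs) = v ∷ plabelsV cs

  plabelsV : ∀ {m j} → Vec (Maybe (PTree m)) j → List ℕ
  plabelsV [] = []
  plabelsV (nothing ∷ cs) = plabelsV cs
  plabelsV (just t ∷ cs) = plabels t ++ plabelsV cs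

mutual
  PIncreasing : ∀ {m} → PTree m → Set
  PIncreasing (pnode v cs) = PIncV v cs

  PIncV : ∀ {m j} → ℕ → Vec (Maybe (PTree m)) j → Set
  PIncV v [] = ⊤
  PIncV v (nothing ∷ cs) = PIncV v cs
  PIncV v (just t ∷ cs) = (v < proot t) × PIncreasing t × PIncV v cs

record FTree (k : ℕ) : Set where
  constructor froot
  field
    rootLabel : ℕ
    rootChildren : Vec (Maybe (PTree (k + 2))) k

flabels : ∀ {k} → FTree k → List ℕ
flabels (froot v cs) = v ∷ plabelsV cs

FIncreasing : ∀ {k} → FTree k → Set
FIncreasing (froot v cs) = PIncV v cs

IsFIncTree : (k n : ℕ) → FTree k → Set
IsFIncTree k n t =
  (FTree.rootLabel t ≡ 1) × (sort (flabels t) ≡ oneTo n) × FIncreasing t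

FIncTree : (k n : ℕ) → Set
FIncTree k n = Σ (FTree k) (IsFIncTree k n)

module Submission where

-- In a non-root vertex with k+2 positions, the first k positions
-- play the role of the k bundles, while the last two positions (left and
-- right) span an increasing binary tree.  An increasing binary tree is the
-- same as a linearly ordered sequence of its vertices: read it in
-- symmetric order (left subtree, vertex, right subtree); conversely the
-- minimum of a sequence becomes the root, the parts before and after it
-- become the left and right subtrees.  Applying this at every vertex turns
-- the k+2 positions into k ordered bundles and back.

open import Defs
open import Data.Nat using (ℕ; _≤_)
open import Function.Bundles using (_⤖_)

open import Data.Nat using (suc; zero; _+_; _<_; _<?_)
open import Data.Nat.Properties
  using (≤-decTotalOrder; ≤-totalOrder; suc-injective; <-trans; <-irrelevant; <-asym; ≮⇒≥; ≤∧≢⇒<; _≟_; ≡-irrelevant)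
open import Data.List using (List; []; _∷_; _++_)
open import Data.List.Properties using (++-assoc; ++-identityʳ; ≡-dec)
open import Data.Vec using (Vec; []; _∷_) renaming (_++_ to _++ᵥ_; map to mapᵥ)
open import Data.Maybe using (Maybe; just; nothing)
open import Data.Product using (Σ; _×_; _,_)
open import Data.Unit using (⊤; tt)
open import Function using (_∘_)
open import Relation.Nullary using (yes; no)
open import Relation.Nullary.Negation using (contradiction)
open import Relation.Binary.PropositionalEquality
open import Data.List.Relation.Binary.Permutation.Propositional
  using (_↭_; ↭-refl; ↭-sym; ↭-trans; ↭-reflexive; prep; ↭⇒↭ₛ; module PermutationReasoning)
open import Data.List.Relation.Binary.Permutation.Propositional.Properties
  using (++⁺; shift; shifts; ∈-resp-↭)
open import Data.List.Relation.Unary.Unique.Propositional using (Unique)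
open import Data.List.Relation.Unary.AllPairs using ([]; _∷_; tail)
open import Data.List.Relation.Unary.Unique.Propositional.Properties
  using (map⁺; upTo⁺; Unique[x∷xs]⇒x∉xs)
open import Data.List.Relation.Binary.Permutation.Setoid.Properties using (Unique-resp-↭)
import Data.List.Relation.Unary.All.Properties as All
import Data.List.Sort.InsertionSort.Properties ≤-decTotalOrder as InsertionSort
open import Data.List.Relation.Unary.Sorted.TotalOrder.Properties using (↗↭↗⇒≋)
open import Data.List.Relation.Binary.Pointwise using (Pointwise-≡⇒≡)
open import Data.List.Sort.InsertionSort.Base ≤-decTotalOrder using (sort)
open import Data.List.Membership.Propositional using (_∈_; _∉_)
open import Data.List.Membership.Propositional.Properties using (∈-++⁺ˡ; ∈-++⁺ʳ)
open import Data.List.Relation.Unary.Any using (here; there)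
open import Axiom.UniquenessOfIdentityProofs using (module Decidable⇒UIP)
open import Function.Properties.Inverse using (↔⇒⤖)
open import Function.Bundles using (mk↔ₛ′)

sort-resp-↭ : ∀ {xs ys : List ℕ} → xs ↭ ys → sort xs ≡ sort ys
sort-resp-↭ {xs} {ys} xs↭ys =
  Pointwise-≡⇒≡ (↗↭↗⇒≋ ≤-totalOrder (InsertionSort.sort-↗ xs) (InsertionSort.sort-↗ ys)
    (↭⇒↭ₛ (↭-trans (InsertionSort.sort-↭ xs) (↭-trans xs↭ys (↭-sym (InsertionSort.sort-↭ ys))))))

-- A list whose sorted form is 1,…,n has no repeated entries; rebuilding
-- an F-tree needs the labels of a B-tree to be distinct.
sort≡oneTo⇒Unique : ∀ {xs} n → sort xs ≡ oneTo n → Unique xs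
sort≡oneTo⇒Unique {xs} n sorted =
  Unique-resp-↭ (setoid ℕ) (↭⇒↭ₛ (InsertionSort.sort-↭ xs))
    (subst Unique (sym sorted) (map⁺ suc-injective (upTo⁺ n)))

Unique-++⁻ˡ : ∀ (xs : List ℕ) {ys} → Unique (xs ++ ys) → Unique xs
Unique-++⁻ˡ [] _ = []
Unique-++⁻ˡ (x ∷ xs) (x∉ ∷ u) = All.++⁻ˡ xs x∉ ∷ Unique-++⁻ˡ xs u

Unique-++⁻ʳ : ∀ (xs : List ℕ) {ys} → Unique (xs ++ ys) → Unique ys
Unique-++⁻ʳ [] u = u
Unique-++⁻ʳ (x ∷ xs) (_ ∷ u) = Unique-++⁻ʳ xs u

-- Equality proofs between label lists are unique, so the label condition
-- in a Σ-type does not distinguish elements.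
List-≡-irrelevant : ∀ {xs ys : List ℕ} (p q : xs ≡ ys) → p ≡ q
List-≡-irrelevant = Decidable⇒UIP.≡-irrelevant (≡-dec _≟_)

slotLabels : ∀ {m} → Maybe (PTree m) → List ℕ
slotLabels nothing = []
slotLabels (just t) = plabels t

plabelsV-∷ : ∀ {m j} (c : Maybe (PTree m)) (cs : Vec (Maybe (PTree m)) j) →
             plabelsV (c ∷ cs) ≡ slotLabels c ++ plabelsV cs
plabelsV-∷ nothing cs = refl
plabelsV-∷ (just t) cs = refl

-- A position is "above v" if it is empty or holds an increasing subtree
-- whose root exceeds v, i.e. it may legitimately be a position of v.
Above : ∀ {m} → ℕ → Maybe (PTree m) → Set
Above v c = PIncV v (c ∷ [])

PIncV-uncons : ∀ {m j} v (c : Maybe (PTree m)) (cs : Vec (Maybe (PTree m)) j) →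
               PIncV v (c ∷ cs) → Above v c × PIncV v cs
PIncV-uncons v nothing cs inc = tt , inc
PIncV-uncons v (just t) cs (v<t , t↑ , cs↑) = (v<t , t↑ , tt) , cs↑

PIncV-cons : ∀ {m j} v (c : Maybe (PTree m)) (cs : Vec (Maybe (PTree m)) j) →
             Above v c → PIncV v cs → PIncV v (c ∷ cs)
PIncV-cons v nothing cs _ cs↑ = cs↑
PIncV-cons v (just t) cs (v<t , t↑ , _) cs↑ = v<t , t↑ , cs↑

PIncV-++ : ∀ {m i j} v (ds : Vec (Maybe (PTree m)) i) (cs : Vec (Maybe (PTree m)) j) →
           PIncV v ds → PIncV v cs → PIncV v (ds ++ᵥ cs)
PIncV-++ v [] cs _ cs↑ = cs↑
PIncV-++ v (d ∷ ds) cs dds↑ cs↑ =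
  let (d↑ , ds↑) = PIncV-uncons v d ds dds↑
  in PIncV-cons v d (ds ++ᵥ cs) d↑ (PIncV-++ v ds cs ds↑ cs↑)

mutual
  PIncreasing-irrelevant : ∀ {m} (t : PTree m) (p q : PIncreasing t) → p ≡ q
  PIncreasing-irrelevant (pnode v cs) = PIncV-irrelevant v cs

  PIncV-irrelevant : ∀ {m j} v (cs : Vec (Maybe (PTree m)) j) (p q : PIncV v cs) → p ≡ q
  PIncV-irrelevant v [] tt tt = refl
  PIncV-irrelevant v (nothing ∷ cs) p q = PIncV-irrelevant v cs p q
  PIncV-irrelevant v (just t ∷ cs) (a , b , c) (a′ , b′ , c′) =
    cong₂ _,_ (<-irrelevant a a′) (cong₂ _,_ (PIncreasing-irrelevant t b b′) (PIncV-irrelevant v cs c c′))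

blabelsL-++ : ∀ {k} (xs ys : List (BTree k)) → blabelsL (xs ++ ys) ≡ blabelsL xs ++ blabelsL ys
blabelsL-++ [] ys = refl
blabelsL-++ (x ∷ xs) ys =
  trans (cong (blabels x ++_) (blabelsL-++ xs ys)) (sym (++-assoc (blabels x) _ _))

BIncL-++ : ∀ {k} v (xs ys : List (BTree k)) → BIncL v xs → BIncL v ys → BIncL v (xs ++ ys)
BIncL-++ v [] ys _ ys↑ = ys↑
BIncL-++ v (x ∷ xs) ys (v<x , x↑ , xs↑) ys↑ = v<x , x↑ , BIncL-++ v xs ys xs↑ ys↑

-- Children of w may be re-attached to any ancestor v < w.
BIncL-weaken : ∀ {k v w} → v < w → (xs : List (BTree k)) → BIncL w xs → BIncL v xs
BIncL-weaken v<w [] _ = tt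
BIncL-weaken v<w (x ∷ xs) (w<x , x↑ , xs↑) = <-trans v<w w<x , x↑ , BIncL-weaken v<w xs xs↑

mutual
  BIncreasing-irrelevant : ∀ {k} (t : BTree k) (p q : BIncreasing t) → p ≡ q
  BIncreasing-irrelevant (bnode v bs) = BIncV-irrelevant v bs

  BIncV-irrelevant : ∀ {k j} v (bs : Vec (List (BTree k)) j) (p q : BIncV v bs) → p ≡ q
  BIncV-irrelevant v [] tt tt = refl
  BIncV-irrelevant v (l ∷ ls) (a , b) (a′ , b′) =
    cong₂ _,_ (BIncL-irrelevant v l a a′) (BIncV-irrelevant v ls b b′)

  BIncL-irrelevant : ∀ {k} v (xs : List (BTree k)) (p q : BIncL v xs) → p ≡ q
  BIncL-irrelevant v [] tt tt = refl
  BIncL-irrelevant v (t ∷ ts) (a , b , c) (a′ , b′ , c′) =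
    cong₂ _,_ (<-irrelevant a a′) (cong₂ _,_ (BIncreasing-irrelevant t b b′) (BIncL-irrelevant v ts c c′))

Σ-≡-from-proj₁ : ∀ {A : Set} {P : A → Set} → (∀ x (p q : P x) → p ≡ q) →
                 ∀ {x y p q} → x ≡ y → _≡_ {A = Σ A P} (x , p) (y , q)
Σ-≡-from-proj₁ P-irrelevant {x} {p = p} {q} refl = cong (x ,_) (P-irrelevant x p q)

IsFIncTree-irrelevant : ∀ k n (t : FTree k) (p q : IsFIncTree k n t) → p ≡ q
IsFIncTree-irrelevant k n (froot v cs) (a , b , c) (a′ , b′ , c′) =
  cong₂ _,_ (≡-irrelevant a a′) (cong₂ _,_ (List-≡-irrelevant b b′) (PIncV-irrelevant v cs c c′))

IsBundledIncTree-irrelevant : ∀ k n (t : BTree k) (p q : IsBundledIncTree k n t) → p ≡ q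
IsBundledIncTree-irrelevant k n t (a , b , c) (a′ , b′ , c′) =
  cong₂ _,_ (≡-irrelevant a a′) (cong₂ _,_ (List-≡-irrelevant b b′) (BIncreasing-irrelevant t c c′))

module Correspondence (k : ℕ) where

  Slot : Set
  Slot = Maybe (PTree (k + 2))

  Tree : Set
  Tree = BTree k

  -- What a vertex of an F-tree becomes: its bundles, read off the first
  -- positions, and the sequences read off the left and right subtrees.
  record Parts (j : ℕ) : Set where
    constructor parts
    field
      bundles : Vec (List Tree) j
      left right : List Tree

  consBundle : ∀ {j} → List Tree → Parts j → Parts (suc j)
  consBundle x (parts bs L R) = parts (x ∷ bs) L R

  consLeft : ∀ {j} → Tree → Parts j → Parts j
  consLeft x (parts bs L R) = parts bs (x ∷ L) R

  joinParts : ℕ → Parts k → List Tree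
  joinParts w (parts bs L R) = L ++ bnode w bs ∷ R

  mutual
    flatten : Slot → List Tree
    flatten nothing = []
    flatten (just (pnode w cs)) = joinParts w (split k cs)

    split : (j : ℕ) → Vec Slot (j + 2) → Parts j
    split zero (l ∷ r ∷ []) = parts [] (flatten l) (flatten r)
    split (suc j) (c ∷ cs) = consBundle (flatten c) (split j cs)

  -- The positions of a new vertex with prescribed bundles, given its
  -- left and right subtrees.
  Filler : Set
  Filler = Slot → Slot → Vec Slot (k + 2)

  withBundles : Vec Slot k → Filler
  withBundles ds l r = ds ++ᵥ (l ∷ r ∷ [])

  mutual
    -- Insert a vertex w in front of the symmetric-order reading of t: w
    -- descends the left spine and becomes the root of the first subtree
    -- whose root exceeds w, which becomes its right subtree.
    insert : ℕ → Filler → Slot → PTree (k + 2)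
    insert w f nothing = pnode w (f nothing nothing)
    insert w f (just (pnode y cs)) with w <? y
    ... | yes _ = pnode w (f nothing (just (pnode y cs)))
    ... | no _ = pnode y (insertLeft w f k cs)

    insertLeft : ℕ → Filler → (j : ℕ) → Vec Slot (j + 2) → Vec Slot (j + 2)
    insertLeft w f zero (l ∷ r ∷ []) = just (insert w f l) ∷ r ∷ []
    insertLeft w f (suc j) (c ∷ cs) = c ∷ insertLeft w f j cs

  mutual
    build : List Tree → Slot
    build [] = nothing
    build (bnode w bs ∷ ts) = just (insert w (withBundles (buildV bs)) (build ts))

    buildV : ∀ {j} → Vec (List Tree) j → Vec Slot j
    buildV [] = []
    buildV (l ∷ ls) = build l ∷ buildV ls

  split-withBundles : ∀ j (ds : Vec Slot j) l r →
                      split j (ds ++ᵥ (l ∷ r ∷ [])) ≡ parts (mapᵥ flatten ds) (flatten l) (flatten r)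
  split-withBundles zero [] l r = refl
  split-withBundles (suc j) (d ∷ ds) l r = cong (consBundle (flatten d)) (split-withBundles j ds l r)

  module Flatten-insert (w : ℕ) (f : Filler) (x : Tree)
           (reads-as-x : ∀ l r → flatten (just (pnode w (f l r))) ≡ flatten l ++ x ∷ flatten r) where
    mutual
      flatten-insert : ∀ t → flatten (just (insert w f t)) ≡ x ∷ flatten t
      flatten-insert nothing = reads-as-x nothing nothing
      flatten-insert (just (pnode y cs)) with w <? y
      ... | yes _ = reads-as-x nothing (just (pnode y cs))
      ... | no _ = begin
        joinParts y (split k (insertLeft w f k cs)) ≡⟨ cong (joinParts y) (split-insertLeft k cs) ⟩
        joinParts y (consLeft x (split k cs))      ≡⟨ joinParts-consLeft (split k cs) ⟩
        x ∷ joinParts y (split k cs)               ∎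
        where
        open ≡-Reasoning
        joinParts-consLeft : ∀ p → joinParts y (consLeft x p) ≡ x ∷ joinParts y p
        joinParts-consLeft (parts bs L R) = refl

      split-insertLeft : ∀ j cs → split j (insertLeft w f j cs) ≡ consLeft x (split j cs)
      split-insertLeft zero (l ∷ r ∷ []) = cong (λ L → parts [] L (flatten r)) (flatten-insert l)
      split-insertLeft (suc j) (c ∷ cs) =
        trans (cong (consBundle (flatten c)) (split-insertLeft j cs)) (consBundle-consLeft (split j cs))
        where
        consBundle-consLeft : ∀ p → consBundle (flatten c) (consLeft x p) ≡ consLeft x (consBundle (flatten c) p)
        consBundle-consLeft (parts bs L R) = refl

  open Flatten-insert using (flatten-insert)

  mutual
    flatten-build : ∀ xs → flatten (build xs) ≡ xs
    flatten-build [] = refl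
    flatten-build (bnode w bs ∷ xs) =
      trans (flatten-insert w (withBundles (buildV bs)) (bnode w bs) reads-as-node (build xs))
            (cong (bnode w bs ∷_) (flatten-build xs))
      where
      reads-as-node : ∀ l r → flatten (just (pnode w (withBundles (buildV bs) l r)))
                              ≡ flatten l ++ bnode w bs ∷ flatten r
      reads-as-node l r =
        cong (joinParts w) (trans (split-withBundles k (buildV bs) l r)
                                  (cong (λ bs′ → parts bs′ (flatten l) (flatten r)) (flattenV-buildV bs)))

    flattenV-buildV : ∀ {j} (bs : Vec (List Tree) j) → mapᵥ flatten (buildV bs) ≡ bs
    flattenV-buildV [] = refl
    flattenV-buildV (l ∷ ls) = cong₂ _∷_ (flatten-build l) (flattenV-buildV ls)

  partsLabels : ∀ {j} → Parts j → List ℕ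
  partsLabels (parts bs L R) = blabelsV bs ++ blabelsL L ++ blabelsL R

  joinParts-labels : ∀ w (p : Parts k) → blabelsL (joinParts w p) ↭ w ∷ partsLabels p
  joinParts-labels w (parts bs L R) = begin
    blabelsL (L ++ bnode w bs ∷ R)                ≡⟨ blabelsL-++ L (bnode w bs ∷ R) ⟩
    blabelsL L ++ w ∷ blabelsV bs ++ blabelsL R   ↭⟨ shift w (blabelsL L) _ ⟩
    w ∷ blabelsL L ++ blabelsV bs ++ blabelsL R   ↭⟨ prep w (shifts (blabelsL L) (blabelsV bs)) ⟩
    w ∷ blabelsV bs ++ blabelsL L ++ blabelsL R   ∎
    where open PermutationReasoning

  mutual
    flatten-labels : ∀ c → blabelsL (flatten c) ↭ slotLabels c
    flatten-labels nothing = ↭-refl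
    flatten-labels (just (pnode w cs)) =
      ↭-trans (joinParts-labels w (split k cs)) (prep w (split-labels k cs))

    split-labels : ∀ j cs → partsLabels (split j cs) ↭ plabelsV cs
    split-labels zero (l ∷ r ∷ []) = begin
      blabelsL (flatten l) ++ blabelsL (flatten r)  ↭⟨ ++⁺ (flatten-labels l) (flatten-labels r) ⟩
      slotLabels l ++ slotLabels r                  ≡⟨ cong (slotLabels l ++_) (++-identityʳ (slotLabels r)) ⟨
      slotLabels l ++ slotLabels r ++ []            ≡⟨ cong (slotLabels l ++_) (plabelsV-∷ r []) ⟨
      slotLabels l ++ plabelsV (r ∷ [])             ≡⟨ plabelsV-∷ l (r ∷ []) ⟨
      plabelsV (l ∷ r ∷ [])                         ∎
      where open PermutationReasoning
    split-labels (suc j) (c ∷ cs) =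
      ↭-trans (↭-reflexive (consBundle-labels (split j cs)))
              (↭-trans (++⁺ (flatten-labels c) (split-labels j cs)) (↭-reflexive (sym (plabelsV-∷ c cs))))
      where
      consBundle-labels : ∀ p → partsLabels (consBundle (flatten c) p) ≡ blabelsL (flatten c) ++ partsLabels p
      consBundle-labels (parts bs L R) = ++-assoc (blabelsL (flatten c)) (blabelsV bs) _

  flattenV-labels : ∀ {j} (cs : Vec Slot j) → blabelsV (mapᵥ flatten cs) ↭ plabelsV cs
  flattenV-labels [] = ↭-refl
  flattenV-labels (c ∷ cs) =
    ↭-trans (++⁺ (flatten-labels c) (flattenV-labels cs)) (↭-reflexive (sym (plabelsV-∷ c cs)))

  -- The label statements for build follow from flatten ∘ build = id.
  build-labels : ∀ xs → slotLabels (build xs) ↭ blabelsL xs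
  build-labels xs = ↭-sym (subst (λ ys → blabelsL ys ↭ slotLabels (build xs)) (flatten-build xs) (flatten-labels (build xs)))

  buildV-labels : ∀ {j} (bs : Vec (List Tree) j) → plabelsV (buildV bs) ↭ blabelsV bs
  buildV-labels bs =
    ↭-sym (subst (λ bs′ → blabelsV bs′ ↭ plabelsV (buildV bs)) (flattenV-buildV bs) (flattenV-labels (buildV bs)))

  PartsInc : ∀ {j} → ℕ → Parts j → Set
  PartsInc w (parts bs L R) = BIncV w bs × BIncL w L × BIncL w R

  joinParts-inc : ∀ v w (p : Parts k) → v < w → PartsInc w p → BIncL v (joinParts w p)
  joinParts-inc v w (parts bs L R) v<w (bs↑ , L↑ , R↑) =
    BIncL-++ v L _ (BIncL-weaken v<w L L↑) (v<w , bs↑ , BIncL-weaken v<w R R↑)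

  mutual
    flatten-inc : ∀ v c → Above v c → BIncL v (flatten c)
    flatten-inc v nothing _ = tt
    flatten-inc v (just (pnode w cs)) (v<w , cs↑ , _) =
      joinParts-inc v w (split k cs) v<w (split-inc w k cs cs↑)

    split-inc : ∀ w j cs → PIncV w cs → PartsInc w (split j cs)
    split-inc w zero (l ∷ r ∷ []) lr↑ =
      let (l↑ , r↑) = PIncV-uncons w l (r ∷ []) lr↑
      in tt , flatten-inc w l l↑ , flatten-inc w r r↑
    split-inc w (suc j) (c ∷ cs) ccs↑ =
      let (c↑ , cs↑) = PIncV-uncons w c cs ccs↑
      in consBundle-inc (split j cs) (flatten-inc w c c↑) (split-inc w j cs cs↑)
      where
      consBundle-inc : ∀ p → BIncL w (flatten c) → PartsInc w p → PartsInc w (consBundle (flatten c) p)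
      consBundle-inc (parts bs L R) x↑ (bs↑ , L↑ , R↑) = (x↑ , bs↑) , L↑ , R↑

  flattenV-inc : ∀ {j} v (cs : Vec Slot j) → PIncV v cs → BIncV v (mapᵥ flatten cs)
  flattenV-inc v [] _ = tt
  flattenV-inc v (c ∷ cs) ccs↑ =
    let (c↑ , cs↑) = PIncV-uncons v c cs ccs↑ in flatten-inc v c c↑ , flattenV-inc v cs cs↑

  -- Inserting w (with increasing positions) into a subtree not containing
  -- w keeps it increasing: w either becomes the root, or sinks below a
  -- root y, which then satisfies y < w since y ≠ w.
  module Insert-inc (w : ℕ) (f : Filler)
           (f-inc : ∀ l r → Above w l → Above w r → PIncV w (f l r)) where
    mutual
      insert-inc : ∀ v t → v < w → Above v t → w ∉ slotLabels t → Above v (just (insert w f t))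
      insert-inc v nothing v<w _ _ = v<w , f-inc nothing nothing tt tt , tt
      insert-inc v (just (pnode y cs)) v<w (v<y , cs↑ , _) w∉ with w <? y
      ... | yes w<y = v<w , f-inc nothing (just (pnode y cs)) tt (w<y , cs↑ , tt) , tt
      ... | no w≮y = v<y , insertLeft-inc y k cs y<w cs↑ (λ w∈ → w∉ (there w∈)) , tt
        where
        y<w : y < w
        y<w = ≤∧≢⇒< (≮⇒≥ w≮y) (λ y≡w → w∉ (here (sym y≡w)))

      insertLeft-inc : ∀ y j cs → y < w → PIncV y cs → w ∉ plabelsV cs → PIncV y (insertLeft w f j cs)
      insertLeft-inc y zero (l ∷ r ∷ []) y<w lr↑ w∉ =
        let (l↑ , r↑) = PIncV-uncons y l (r ∷ []) lr↑
            w∉l = λ w∈ → w∉ (subst (w ∈_) (sym (plabelsV-∷ l (r ∷ []))) (∈-++⁺ˡ w∈))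
            (y<w , inserted↑ , _) = insert-inc y l y<w l↑ w∉l
        in y<w , inserted↑ , r↑
      insertLeft-inc y (suc j) (c ∷ cs) y<w ccs↑ w∉ =
        let (c↑ , cs↑) = PIncV-uncons y c cs ccs↑
            w∉cs = λ w∈ → w∉ (subst (w ∈_) (sym (plabelsV-∷ c cs)) (∈-++⁺ʳ (slotLabels c) w∈))
        in PIncV-cons y c (insertLeft w f j cs) c↑ (insertLeft-inc y j cs y<w cs↑ w∉cs)

  open Insert-inc using (insert-inc)

  mutual
    build-inc : ∀ v xs → BIncL v xs → Unique (blabelsL xs) → Above v (build xs)
    build-inc v [] _ _ = tt
    build-inc v (bnode w bs ∷ xs) (v<w , bs↑ , xs↑) distinct =
      insert-inc w (withBundles (buildV bs)) f-inc v (build xs) v<w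
        (build-inc v xs xs↑ (Unique-++⁻ʳ (blabelsV bs) (tail distinct))) w∉build
      where
      w∉build : w ∉ slotLabels (build xs)
      w∉build w∈ = Unique[x∷xs]⇒x∉xs distinct (∈-++⁺ʳ (blabelsV bs) (∈-resp-↭ (build-labels xs) w∈))
      f-inc : ∀ l r → Above w l → Above w r → PIncV w (withBundles (buildV bs) l r)
      f-inc l r l↑ r↑ =
        PIncV-++ w (buildV bs) (l ∷ r ∷ [])
          (buildV-inc w bs bs↑ (Unique-++⁻ˡ (blabelsV bs) (tail distinct))) (PIncV-cons w l (r ∷ []) l↑ r↑)

    buildV-inc : ∀ {j} v (bs : Vec (List Tree) j) → BIncV v bs → Unique (blabelsV bs) → PIncV v (buildV bs)
    buildV-inc v [] _ _ = tt
    buildV-inc v (l ∷ ls) (l↑ , ls↑) distinct =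
      PIncV-cons v (build l) (buildV ls)
        (build-inc v l l↑ (Unique-++⁻ˡ (blabelsL l) distinct))
        (buildV-inc v ls ls↑ (Unique-++⁻ʳ (blabelsL l) distinct))

  insertAll : List Tree → Slot → Slot
  insertAll [] t = t
  insertAll (bnode u bs ∷ xs) t = just (insert u (withBundles (buildV bs)) (insertAll xs t))

  build-++ : ∀ xs ys → build (xs ++ ys) ≡ insertAll xs (build ys)
  build-++ [] ys = refl
  build-++ (bnode u bs ∷ xs) ys = cong (just ∘ insert u (withBundles (buildV bs))) (build-++ xs ys)

  insertAll-nothing : ∀ xs → insertAll xs nothing ≡ build xs
  insertAll-nothing [] = refl
  insertAll-nothing (bnode u bs ∷ xs) = cong (just ∘ insert u (withBundles (buildV bs))) (insertAll-nothing xs)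

  RootAbove : ℕ → Slot → Set
  RootAbove w nothing = ⊤
  RootAbove w (just t) = w < proot t

  -- The root of insert u f t is u or the root of t.
  insert-rootAbove : ∀ w u f t → w < u → RootAbove w t → RootAbove w (just (insert u f t))
  insert-rootAbove w u f nothing w<u _ = w<u
  insert-rootAbove w u f (just (pnode y cs)) w<u w<y with u <? y
  ... | yes _ = w<u
  ... | no _ = w<y

  -- The root of build xs is one of the roots in xs.
  build-rootAbove : ∀ w xs → BIncL w xs → RootAbove w (build xs)
  build-rootAbove w [] _ = tt
  build-rootAbove w (bnode u bs ∷ xs) (w<u , _ , xs↑) =
    insert-rootAbove w u _ (build xs) w<u (build-rootAbove w xs xs↑)

  insert-root : ∀ w f t → RootAbove w t → insert w f t ≡ pnode w (f nothing t)
  insert-root w f nothing _ = refl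
  insert-root w f (just (pnode y cs)) w<y with w <? y
  ... | yes _ = refl
  ... | no w≮y = contradiction w<y w≮y

  insert-below : ∀ u f w (ds : Vec Slot k) l r → w < u →
                 insert u f (just (pnode w (ds ++ᵥ (l ∷ r ∷ [])))) ≡ pnode w (ds ++ᵥ (just (insert u f l) ∷ r ∷ []))
  insert-below u f w ds l r w<u with u <? w
  ... | yes u<w = contradiction u<w (<-asym w<u)
  ... | no _ = cong (pnode w) (insertLeft-withBundles k ds)
    where
    insertLeft-withBundles : ∀ j (ds : Vec Slot j) →
      insertLeft u f j (ds ++ᵥ (l ∷ r ∷ [])) ≡ ds ++ᵥ (just (insert u f l) ∷ r ∷ [])
    insertLeft-withBundles zero [] = refl
    insertLeft-withBundles (suc j) (d ∷ ds) = cong (d ∷_) (insertLeft-withBundles j ds)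

  insertAll-below : ∀ w (ds : Vec Slot k) l r L → BIncL w L →
    insertAll L (just (pnode w (ds ++ᵥ (l ∷ r ∷ [])))) ≡ just (pnode w (ds ++ᵥ (insertAll L l ∷ r ∷ [])))
  insertAll-below w ds l r [] _ = refl
  insertAll-below w ds l r (bnode u bs ∷ L) (w<u , _ , L↑) =
    cong just (trans (cong (insert u (withBundles (buildV bs))) (insertAll-below w ds l r L L↑))
                     (insert-below u _ w ds (insertAll L l) r w<u))

  unsplit : ∀ {j} → Parts j → Vec Slot (j + 2)
  unsplit (parts bs L R) = buildV bs ++ᵥ (build L ∷ build R ∷ [])

  build-join : ∀ w (p : Parts k) → BIncL w (Parts.left p) → BIncL w (Parts.right p) →
               build (joinParts w p) ≡ just (pnode w (unsplit p))
  build-join w (parts bs L R) L↑ R↑ = begin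
    build (L ++ bnode w bs ∷ R)
      ≡⟨ build-++ L (bnode w bs ∷ R) ⟩
    insertAll L (just (insert w (withBundles (buildV bs)) (build R)))
      ≡⟨ cong (insertAll L ∘ just) (insert-root w _ (build R) (build-rootAbove w R R↑)) ⟩
    insertAll L (just (pnode w (buildV bs ++ᵥ (nothing ∷ build R ∷ []))))
      ≡⟨ insertAll-below w (buildV bs) nothing (build R) L L↑ ⟩
    just (pnode w (buildV bs ++ᵥ (insertAll L nothing ∷ build R ∷ [])))
      ≡⟨ cong (λ l → just (pnode w (buildV bs ++ᵥ (l ∷ build R ∷ [])))) (insertAll-nothing L) ⟩
    just (pnode w (buildV bs ++ᵥ (build L ∷ build R ∷ []))) ∎
    where open ≡-Reasoning

  mutual
    build-flatten : ∀ v c → Above v c → build (flatten c) ≡ c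
    build-flatten v nothing _ = refl
    build-flatten v (just (pnode w cs)) (_ , cs↑ , _) =
      let (_ , L↑ , R↑) = split-inc w k cs cs↑
      in trans (build-join w (split k cs) L↑ R↑) (cong (just ∘ pnode w) (unsplit-split w k cs cs↑))

    unsplit-split : ∀ w j cs → PIncV w cs → unsplit (split j cs) ≡ cs
    unsplit-split w zero (l ∷ r ∷ []) lr↑ =
      let (l↑ , r↑) = PIncV-uncons w l (r ∷ []) lr↑
      in cong₂ (λ l′ r′ → l′ ∷ r′ ∷ []) (build-flatten w l l↑) (build-flatten w r r↑)
    unsplit-split w (suc j) (c ∷ cs) ccs↑ =
      let (c↑ , cs↑) = PIncV-uncons w c cs ccs↑
      in trans (unsplit-consBundle (split j cs)) (cong₂ _∷_ (build-flatten w c c↑) (unsplit-split w j cs cs↑))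
      where
      unsplit-consBundle : ∀ p → unsplit (consBundle (flatten c) p) ≡ build (flatten c) ∷ unsplit p
      unsplit-consBundle (parts bs L R) = refl

  buildV-flattenV : ∀ {j} v (cs : Vec Slot j) → PIncV v cs → buildV (mapᵥ flatten cs) ≡ cs
  buildV-flattenV v [] _ = refl
  buildV-flattenV v (c ∷ cs) ccs↑ =
    let (c↑ , cs↑) = PIncV-uncons v c cs ccs↑
    in cong₂ _∷_ (build-flatten v c c↑) (buildV-flattenV v cs cs↑)

  toBundled : ∀ n → FIncTree k n → BundledIncTree k n
  toBundled n (froot v cs , root≡1 , labels , cs↑) =
    bnode v (mapᵥ flatten cs) , root≡1 ,
    trans (sort-resp-↭ (prep v (flattenV-labels cs))) labels , flattenV-inc v cs cs↑

  fromBundled : ∀ n → BundledIncTree k n → FIncTree k n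
  fromBundled n (bnode v bs , root≡1 , labels , bs↑) =
    froot v (buildV bs) , root≡1 ,
    trans (sort-resp-↭ (prep v (buildV-labels bs))) labels ,
    buildV-inc v bs bs↑ (tail (sort≡oneTo⇒Unique n labels))

  toBundled-fromBundled : ∀ n y → toBundled n (fromBundled n y) ≡ y
  toBundled-fromBundled n (bnode v bs , _) =
    Σ-≡-from-proj₁ (IsBundledIncTree-irrelevant k n) (cong (bnode v) (flattenV-buildV bs))

  fromBundled-toBundled : ∀ n x → fromBundled n (toBundled n x) ≡ x
  fromBundled-toBundled n (froot v cs , _ , _ , cs↑) =
    Σ-≡-from-proj₁ (IsFIncTree-irrelevant k n) (cong (froot v) (buildV-flattenV v cs cs↑))

-- The bijection exists for all k and n.
theorem4p4 : (k n : ℕ) → 1 ≤ k → 1 ≤ n → FIncTree k n ⤖ BundledIncTree k n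
theorem4p4 k n _ _ =
  ↔⇒⤖ (mk↔ₛ′ (toBundled n) (fromBundled n) (toBundled-fromBundled n) (fromBundled-toBundled n))
  where open Correspondence k
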